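{- Let $X$ be a non-empty finite set, $k\ge 1$, and $R$ a $k$-ary transit function on $X$. Then $R$ is monotone if and only if there is a DAG $G$ with leaf set $X$ that has the $k$-$\mathrm{lca}$-property and satisfies $\mathscr{C}_G=\mathscr{C}_R$ and $R_{\mathscr{C}_G}=R$.
   Context: $X^{(k)}$ denotes the set of non-empty subsets of $X$ of cardinality at most $k$. A $k$-ary transit function on $X$ is a map $R:X^{(k)}\to 2^X$ (equivalently a symmetric map $X^k\to 2^X$) with $U\subseteq R(U)$ for all $U\in X^{(k)}$ and $R(\{x\})=\{x\}$ for all $x\in X$. It is monotone if for all $U,W\in X^{(k)}$, $W\subseteq R(U)$ implies $R(W)\subseteq R(U)$. Its system of transit sets is $\mathscr{C}_R=\{R(U)\mid U\in X^{(k)}\}$. For a set system $\mathscr{C}$ on $X$, its canonical $k$-ary transit function is $R_{\mathscr{C}}(U)=\bigcap\{C\in\mathscr{C}\mid U\subseteq C\}$ for $U\in X^{(k)}$. For a finite DAG $G$, write $v\preceq w$ if there is a directed path (possibly of length $0$) from $w$ to $v$; the leaf set is the set of $\preceq$-minimal vertices; the cluster of $v$ is $\mathrm{C}(v)=\{x \text{ leaf}\mid x\preceq v\}$ and $\mathscr{C}_G=\{\mathrm{C}(v)\mid v\in V(G)\}$. A least common ancestor of $Y\subseteq V(G)$ is a $\preceq$-minimal element of the set of common ancestors of all elements of $Y$; $\mathrm{lca}(Y)$ is defined if there is exactly one such vertex. $G$ has the $k$-$\mathrm{lca}$-property if $\mathrm{lca}(A)$ is defined for every non-empty set $A$ of at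 most $k$ leaves. -}

module Defs where

open import Data.Nat using (ℕ; suc; _≤_)
open import Data.Fin using (Fin)
open import Data.Fin.Subset using (Subset; _∈_; _⊆_; ⁅_⁆; ∣_∣; Nonempty) public
open import Data.Bool using (Bool; true)
open import Data.Product using (Σ; ∃; _×_; _,_)
open import Relation.Binary.PropositionalEquality using (_≡_)
open import Relation.Binary.Construct.Closure.ReflexiveTransitive using (Star)
open import Relation.Binary.Construct.Closure.Transitive using (TransClosure)
open import Relation.Nullary using (¬_)
open import Function.Bundles using (_⇔_)

InXk : ∀ {n} → ℕ → Subset n → Set
InXk k U = Nonempty U × ∣ U ∣ ≤ k

-- A k-ary transit function on Fin n: a map R : Subset n → Subset n whose
-- values are only relevant on X^(k) (values elsewhere are ignored).
IsTransit : ∀ {n} → ℕ → (Subset n → Subset n) → Set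
IsTransit {n} k R =
  (∀ U → InXk k U → U ⊆ R U) × (∀ (x : Fin n) → R ⁅ x ⁆ ≡ ⁅ x ⁆)

IsMonotone : ∀ {n} → ℕ → (Subset n → Subset n) → Set
IsMonotone {n} k R =
  ∀ (U W : Subset n) → InXk k U → InXk k W → W ⊆ R U → R W ⊆ R U

Edge : ∀ {m} → (Fin m → Fin m → Bool) → Fin m → Fin m → Set
Edge E u v = E u v ≡ true

IsAcyclic : ∀ {m} → (Fin m → Fin m → Bool) → Set
IsAcyclic {m} E = ∀ (v : Fin m) → ¬ TransClosure (Edge E) v v

_⪯[_]_ : ∀ {m} → Fin m → (Fin m → Fin m → Bool) → Fin m → Set
v ⪯[ E ] w = Star (Edge E) w v

IsLeaf : ∀ {m} → (Fin m → Fin m → Bool) → Fin m → Set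
IsLeaf {m} E v = ∀ (w : Fin m) → w ⪯[ E ] v → w ≡ v

-- The leaf set of the DAG is X = Fin n, identified via an injective map
-- ι : Fin n → Fin m whose image is exactly the set of leaves.
LeafSetIs : ∀ {n m} → (Fin m → Fin m → Bool) → (Fin n → Fin m) → Set
LeafSetIs {n} {m} E ι =
  (∀ (x y : Fin n) → ι x ≡ ι y → x ≡ y) ×
  (∀ (v : Fin m) → IsLeaf E v ⇔ (∃ λ (x : Fin n) → ι x ≡ v))

InCluster : ∀ {n m} → (Fin m → Fin m → Bool) → (Fin n → Fin m) → Fin n → Fin m → Set
InCluster E ι x v = ι x ⪯[ E ] v

CommonAnc : ∀ {n m} → (Fin m → Fin m → Bool) → (Fin n → Fin m) → Subset n → Fin m → Set
CommonAnc {n} E ι A v = ∀ (x : Fin n) → x ∈ A → ι x ⪯[ E ] v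

IsLCA : ∀ {n m} → (Fin m → Fin m → Bool) → (Fin n → Fin m) → Subset n → Fin m → Set
IsLCA {n} {m} E ι A v =
  CommonAnc E ι A v × (∀ (w : Fin m) → CommonAnc E ι A w → w ⪯[ E ] v → w ≡ v)

LcaDefined : ∀ {n m} → (Fin m → Fin m → Bool) → (Fin n → Fin m) → Subset n → Set
LcaDefined {n} {m} E ι A =
  ∃ λ (v : Fin m) → IsLCA E ι A v × (∀ (w : Fin m) → IsLCA E ι A w → w ≡ v)

HasKLcaProperty : ∀ {n m} → ℕ → (Fin m → Fin m → Bool) → (Fin n → Fin m) → Set
HasKLcaProperty {n} k E ι = ∀ (A : Subset n) → InXk k A → LcaDefined E ι A

SameSetSystem : ∀ {n m} → ℕ → (Fin m → Fin m → Bool) → (Fin n → Fin m) →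
                (Subset n → Subset n) → Set
SameSetSystem {n} {m} k E ι R =
  (∀ (v : Fin m) → ∃ λ (U : Subset n) → InXk k U ×
       (∀ (x : Fin n) → (x ∈ R U) ⇔ InCluster E ι x v)) ×
  (∀ (U : Subset n) → InXk k U → ∃ λ (v : Fin m) →
       (∀ (x : Fin n) → (x ∈ R U) ⇔ InCluster E ι x v))

CanonicalIs : ∀ {n m} → ℕ → (Fin m → Fin m → Bool) → (Fin n → Fin m) →
              (Subset n → Subset n) → Set
CanonicalIs {n} {m} k E ι R =
  ∀ (U : Subset n) → InXk k U → ∀ (x : Fin n) →
    (x ∈ R U) ⇔ (∀ (v : Fin m) → (∀ (y : Fin n) → y ∈ U → InCluster E ι y v) →
                                 InCluster E ι x v)

RepresentingDAG : ∀ {n} → ℕ → (Subset n → Subset n) → Set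
RepresentingDAG {n} k R =
  ∃ λ (m : ℕ) → Σ (Fin m → Fin m → Bool) λ E → Σ (Fin n → Fin m) λ ι →
    IsAcyclic E × LeafSetIs E ι × HasKLcaProperty k E ι ×
    SameSetSystem k E ι R × CanonicalIs k E ι R

module Submission where

open import Defs
open import Data.Nat using (ℕ; zero; suc; _+_; _≤_; _<_; _≤?_; s≤s)
open import Data.Nat.Properties using (<-irrefl; <-trans)
open import Data.Fin using (Fin; splitAt; join; _↑ˡ_; _↑ʳ_)
  renaming (zero to fz; _≟_ to _≟F_)
open import Data.Fin.Subset using (Subset; _⊂_; inside; outside)
open import Data.Fin.Subset.Properties using (anySubset?; nonempty?; _⊂?_; _∈?_;
  x∈⁅x⁆; x∈⁅y⁆⇒x≡y; ∣⁅x⁆∣≡1; ⊆-antisym; p⊂q⇒p⊆q; p⊂q⇒∣p∣<∣q∣; ∣p∣≤n)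
open import Data.Fin.Properties using (splitAt-↑ˡ; splitAt-↑ʳ; join-splitAt)
open import Data.Vec using ([]; _∷_)
open import Data.Vec.Properties using (≡-dec)
open import Data.Bool using (Bool; if_then_else_)
open import Data.Bool.Properties using (T-≡) renaming (_≟_ to _≟B_)
open import Data.Product using (∃; _×_; _,_; proj₁; proj₂)
open import Data.Sum using (_⊎_; inj₁; inj₂)
open import Data.Empty using (⊥-elim)
open import Relation.Unary using (Decidable)
open import Relation.Nullary using (¬_; Dec; yes; no)
open import Relation.Nullary.Decidable
  using (⌊_⌋; _×-dec_; _⊎-dec_; ¬?; toWitness; fromWitness)
open import Relation.Binary.PropositionalEquality using (_≡_; refl; sym; trans; cong; subst)
open import Relation.Binary.Construct.Closure.ReflexiveTransitive using (Star; ε; _◅_; _◅◅_)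
open import Relation.Binary.Construct.Closure.Transitive using (TransClosure; [_]; _∷_)
open import Function.Bundles using (_⇔_; mk⇔; Equivalence)

-- The DAG is the strict inclusion order on the transit sets; the singletons are
-- its leaves.  For U ∈ X^(k) the vertex R(U) is lca(U): the cluster of every
-- common ancestor of U is a transit set containing U, hence contains R(U) by
-- monotonicity.  Conversely, W ⊆ R(U) = C(v) makes v a common ancestor of W, so
-- R(W) = R_𝒞(W) ⊆ C(v).  The vertices are the codes of all subsets of X; a code
-- of a non-transit set gets a single arc to the leaf 0, so its cluster {0} is
-- already a transit set.

subsetCount : ℕ → ℕ
subsetCount zero    = 1
subsetCount (suc n) = subsetCount n + subsetCount n

toFin : ∀ {n} → Subset n → Fin (subsetCount n)
toFin []                    = fz
toFin {suc n} (outside ∷ p) = toFin p ↑ˡ subsetCount n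
toFin {suc n} (inside  ∷ p) = subsetCount n ↑ʳ toFin p

fromFin : ∀ {n} → Fin (subsetCount n) → Subset n
fromFin {zero}  _ = []
fromFin {suc n} i with splitAt (subsetCount n) i
... | inj₁ j = outside ∷ fromFin j
... | inj₂ j = inside  ∷ fromFin j

fromFin-toFin : ∀ {n} (p : Subset n) → fromFin (toFin p) ≡ p
fromFin-toFin [] = refl
fromFin-toFin {suc n} (outside ∷ p)
  rewrite splitAt-↑ˡ (subsetCount n) (toFin p) (subsetCount n) | fromFin-toFin p = refl
fromFin-toFin {suc n} (inside ∷ p)
  rewrite splitAt-↑ʳ (subsetCount n) (subsetCount n) (toFin p) | fromFin-toFin p = refl

splitAt≡⇒join≡ : ∀ m {n} {i : Fin (m + n)} {s} → splitAt m i ≡ s → join m n s ≡ i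
splitAt≡⇒join≡ m {n} {i} refl = join-splitAt m n i

toFin-fromFin : ∀ {n} (i : Fin (subsetCount n)) → toFin (fromFin {n} i) ≡ i
toFin-fromFin {zero} fz = refl
toFin-fromFin {suc n} i with splitAt (subsetCount n) i in split≡
... | inj₁ j = trans (cong (_↑ˡ subsetCount n) (toFin-fromFin {n} j))
                     (splitAt≡⇒join≡ (subsetCount n) split≡)
... | inj₂ j = trans (cong (subsetCount n ↑ʳ_) (toFin-fromFin {n} j))
                     (splitAt≡⇒join≡ (subsetCount n) split≡)

fromFin-injective : ∀ {n} {i j : Fin (subsetCount n)} → fromFin {n} i ≡ fromFin j → i ≡ j
fromFin-injective {n} {i} {j} eq =
  trans (sym (toFin-fromFin {n} i)) (trans (cong toFin eq) (toFin-fromFin {n} j))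

⊆∧⊄⇒⊇ : ∀ {n} {p q : Subset n} → p ⊆ q → ¬ p ⊂ q → q ⊆ p
⊆∧⊄⇒⊇ {p = p} p⊆q p⊄q {x} x∈q with x ∈? p
... | yes x∈p = x∈p
... | no  x∉p = ⊥-elim (p⊄q (p⊆q , x , x∈q , x∉p))

module _ {m} {E : Fin m → Fin m → Bool} where

  edge◅⇒⁺ : ∀ {u v w} → Edge E u v → Star (Edge E) v w → TransClosure (Edge E) u w
  edge◅⇒⁺ e ε        = [ e ]
  edge◅⇒⁺ e (e′ ◅ p) = e ∷ edge◅⇒⁺ e′ p

  acyclic⇒⪯-antisym : IsAcyclic E → ∀ {v w} → v ⪯[ E ] w → w ⪯[ E ] v → v ≡ w
  acyclic⇒⪯-antisym acyclic ε       _ = refl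
  acyclic⇒⪯-antisym acyclic (e ◅ p) q = ⊥-elim (acyclic _ (edge◅⇒⁺ e (p ◅◅ q)))

module InclusionDAG {n} (𝒞 : Subset (suc n) → Set) (𝒞? : Decidable 𝒞)
                    (𝒞-singleton : ∀ x → 𝒞 ⁅ x ⁆)
                    (𝒞-nonempty : ∀ {C} → 𝒞 C → Nonempty C) where

  Vertex : Set
  Vertex = Fin (subsetCount (suc n))

  label : Vertex → Subset (suc n)
  label = fromFin

  Active : Vertex → Set
  Active u = 𝒞 (label u)

  active? : Decidable Active
  active? u = 𝒞? (label u)

  leaf : Fin (suc n) → Vertex
  leaf x = toFin ⁅ x ⁆

  Arc : Vertex → Vertex → Set
  Arc u v = (Active u × Active v × label v ⊂ label u) ⊎ (¬ Active u × v ≡ leaf fz)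

  arc? : ∀ u v → Dec (Arc u v)
  arc? u v = (active? u ×-dec active? v ×-dec (label v ⊂? label u))
             ⊎-dec (¬? (active? u) ×-dec (v ≟F leaf fz))

  E : Vertex → Vertex → Bool
  E u v = ⌊ arc? u v ⌋

  _⪯_ : Vertex → Vertex → Set
  v ⪯ w = v ⪯[ E ] w

  ⪯-trans : ∀ {u v w} → u ⪯ v → v ⪯ w → u ⪯ w
  ⪯-trans u⪯v v⪯w = v⪯w ◅◅ u⪯v

  edge⇒arc : ∀ {u v} → Edge E u v → Arc u v
  edge⇒arc {u} {v} e = toWitness {a? = arc? u v} (Equivalence.from T-≡ e)

  arc⇒edge : ∀ {u v} → Arc u v → Edge E u v
  arc⇒edge {u} {v} a = Equivalence.to T-≡ (fromWitness {a? = arc? u v} a)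

  toFin-active : ∀ {C} → 𝒞 C → Active (toFin C)
  toFin-active {C} = subst 𝒞 (sym (fromFin-toFin C))

  active-leaf : ∀ x → Active (leaf x)
  active-leaf x = toFin-active (𝒞-singleton x)

  label-leaf : ∀ x → label (leaf x) ≡ ⁅ x ⁆
  label-leaf x = fromFin-toFin ⁅ x ⁆

  ∈label-leaf : ∀ x → x ∈ label (leaf x)
  ∈label-leaf x = subst (x ∈_) (sym (label-leaf x)) (x∈⁅x⁆ x)

  ∈label-leaf⇒≡ : ∀ {x y} → y ∈ label (leaf x) → y ≡ x
  ∈label-leaf⇒≡ {x} y∈ = x∈⁅y⁆⇒x≡y x (subst (_ ∈_) (label-leaf x) y∈)

  below-active : ∀ {v w} → Active w → v ⪯ w → Active v × label v ⊆ label w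
  below-active a ε = a , λ x∈ → x∈
  below-active a (e ◅ p) with edge⇒arc e
  ... | inj₁ (_ , az , z⊂w) =
    let (av , v⊆z) = below-active az p in av , λ x∈ → p⊂q⇒p⊆q z⊂w (v⊆z x∈)
  ... | inj₂ (¬a , _)       = ⊥-elim (¬a a)

  below-inactive : ∀ {v w} → ¬ Active w → v ⪯ w → v ≡ w ⊎ v ⪯ leaf fz
  below-inactive _ ε = inj₁ refl
  below-inactive ¬a (e ◅ p) with edge⇒arc e
  ... | inj₁ (a , _)     = ⊥-elim (¬a a)
  ... | inj₂ (_ , refl) = inj₂ p

  leaf0⪯inactive : ∀ {w} → ¬ Active w → leaf fz ⪯ w
  leaf0⪯inactive ¬a = arc⇒edge (inj₂ (¬a , refl)) ◅ ε

  ⊆⇒⪯ : ∀ {u v} → Active u → Active v → label v ⊆ label u → v ⪯ u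
  ⊆⇒⪯ {u} {v} au av v⊆u with label v ⊂? label u
  ... | yes v⊂u = arc⇒edge (inj₁ (au , av , v⊂u)) ◅ ε
  ... | no  v⊄u = subst (_⪯ u) (fromFin-injective (⊆-antisym (⊆∧⊄⇒⊇ v⊆u v⊄u) v⊆u)) ε

  ∈label⇒leaf⪯ : ∀ {v x} → Active v → x ∈ label v → leaf x ⪯ v
  ∈label⇒leaf⪯ {v} {x} av x∈ =
    ⊆⇒⪯ av (active-leaf x) (λ y∈ → subst (_∈ label v) (sym (∈label-leaf⇒≡ y∈)) x∈)

  leaf⪯⇒∈label : ∀ {v x} → Active v → leaf x ⪯ v → x ∈ label v
  leaf⪯⇒∈label av p = proj₂ (below-active av p) (∈label-leaf _)

  cluster-active : ∀ {v} → Active v → ∀ x → x ∈ label v ⇔ InCluster E leaf x v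
  cluster-active av x = mk⇔ (∈label⇒leaf⪯ av) (leaf⪯⇒∈label av)

  cluster-inactive : ∀ {v} → ¬ Active v → ∀ x → x ∈ ⁅ fz ⁆ ⇔ InCluster E leaf x v
  cluster-inactive ¬a x = mk⇔ to from
    where
    to : x ∈ ⁅ fz ⁆ → InCluster E leaf x _
    to x∈ rewrite x∈⁅y⁆⇒x≡y fz x∈ = leaf0⪯inactive ¬a
    from : InCluster E leaf x _ → x ∈ ⁅ fz ⁆
    from p with below-inactive ¬a p
    ... | inj₁ refl = ⊥-elim (¬a (active-leaf x))
    ... | inj₂ q    = subst (x ∈_) (label-leaf fz) (leaf⪯⇒∈label (active-leaf fz) q)

  active-ancestor : ∀ w → ∃ λ w′ → Active w′ × w′ ⪯ w ×
                      (∀ x → InCluster E leaf x w → InCluster E leaf x w′)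
  active-ancestor w with active? w
  ... | yes a  = w , a , ε , λ _ p → p
  ... | no  ¬a = leaf fz , active-leaf fz , leaf0⪯inactive ¬a , λ x p →
    let x∈⁅0⁆ = Equivalence.from (cluster-inactive ¬a x) p
    in ∈label⇒leaf⪯ (active-leaf fz) (subst (x ∈_) (sym (label-leaf fz)) x∈⁅0⁆)

  rank : Vertex → ℕ
  rank u = if ⌊ active? u ⌋ then ∣ label u ∣ else suc (suc n)

  rank-active : ∀ {u} → Active u → rank u ≡ ∣ label u ∣
  rank-active {u} a with active? u
  ... | yes _  = refl
  ... | no  ¬a = ⊥-elim (¬a a)

  rank-inactive : ∀ {u} → ¬ Active u → rank u ≡ suc (suc n)
  rank-inactive {u} ¬a with active? u
  ... | yes a = ⊥-elim (¬a a)
  ... | no  _ = refl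

  rank-edge : ∀ {u v} → Edge E u v → rank v < rank u
  rank-edge e with edge⇒arc e
  ... | inj₁ (au , av , v⊂u) rewrite rank-active au | rank-active av = p⊂q⇒∣p∣<∣q∣ v⊂u
  ... | inj₂ (¬a , refl) rewrite rank-inactive ¬a | rank-active (active-leaf fz) =
    s≤s (∣p∣≤n (label (leaf fz)))

  rank-path : ∀ {u v} → TransClosure (Edge E) u v → rank v < rank u
  rank-path [ e ]   = rank-edge e
  rank-path (e ∷ p) = <-trans (rank-path p) (rank-edge e)

  acyclic : IsAcyclic E
  acyclic v cycle = <-irrefl refl (rank-path cycle)

  leafSet : LeafSetIs E leaf
  leafSet = leaf-injective , λ v → mk⇔ (leaf⇒∃ v) ∃⇒leaf
    where
    leaf-injective : ∀ x y → leaf x ≡ leaf y → x ≡ y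
    leaf-injective x y eq = ∈label-leaf⇒≡ (subst (λ u → x ∈ label u) eq (∈label-leaf x))
    leaf⇒∃ : ∀ v → IsLeaf E v → ∃ λ x → leaf x ≡ v
    leaf⇒∃ v minimal with active? v
    ... | no ¬a = fz , minimal (leaf fz) (leaf0⪯inactive ¬a)
    ... | yes av with 𝒞-nonempty av
    ...   | x , x∈ = x , minimal (leaf x) (∈label⇒leaf⪯ av x∈)
    ∃⇒leaf : ∀ {v} → (∃ λ x → leaf x ≡ v) → IsLeaf E v
    ∃⇒leaf (x , refl) w p with below-active (active-leaf x) p
    ... | aw , w⊆x with 𝒞-nonempty aw
    ...   | y , y∈w =
      let x∈w = subst (_∈ label w) (∈label-leaf⇒≡ {x} (w⊆x y∈w)) y∈w
      in fromFin-injective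
           (⊆-antisym w⊆x (λ z∈ → subst (_∈ label w) (sym (∈label-leaf⇒≡ {x} z∈)) x∈w))

representingDAG⇒monotone : ∀ {n k} {R : Subset n → Subset n} →
                           RepresentingDAG k R → IsMonotone k R
representingDAG⇒monotone (_ , _ , _ , _ , _ , _ , (_ , transit⇒cluster) , canonical)
                         U W U∈Xk W∈Xk W⊆RU {x} x∈RW
  with transit⇒cluster U U∈Xk
... | v , RU≡Cv = Equivalence.from (RU≡Cv x)
  (Equivalence.to (canonical W W∈Xk x) x∈RW v
    (λ y y∈W → Equivalence.to (RU≡Cv y) (W⊆RU y∈W)))

module TransitDAG (n k : ℕ) (k≥1 : 1 ≤ k) (R : Subset (suc n) → Subset (suc n))
                  (transit : IsTransit k R) (monotone : IsMonotone k R) where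

  TransitSet : Subset (suc n) → Set
  TransitSet C = ∃ λ U → InXk k U × R U ≡ C

  transitSet? : Decidable TransitSet
  transitSet? C =
    anySubset? λ U → (nonempty? U ×-dec (∣ U ∣ ≤? k)) ×-dec ≡-dec _≟B_ (R U) C

  ⁅⁆∈Xk : ∀ (x : Fin (suc n)) → InXk k ⁅ x ⁆
  ⁅⁆∈Xk x = (x , x∈⁅x⁆ x) , subst (_≤ k) (sym (∣⁅x⁆∣≡1 x)) k≥1

  transitSet-⁅⁆ : ∀ (x : Fin (suc n)) → TransitSet ⁅ x ⁆
  transitSet-⁅⁆ x = ⁅ x ⁆ , ⁅⁆∈Xk x , proj₂ transit x

  transitSet-nonempty : ∀ {C} → TransitSet C → Nonempty C
  transitSet-nonempty (U , U∈Xk@((x , x∈U) , _) , refl) =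
    x , proj₁ transit U U∈Xk x∈U

  open InclusionDAG TransitSet transitSet? transitSet-⁅⁆ transitSet-nonempty

  R-least : ∀ {A C} → InXk k A → TransitSet C → A ⊆ C → R A ⊆ C
  R-least A∈Xk (U , U∈Xk , refl) = monotone U _ U∈Xk A∈Xk

  vertexOf : Subset (suc n) → Vertex
  vertexOf A = toFin (R A)

  label-vertexOf : ∀ A → label (vertexOf A) ≡ R A
  label-vertexOf A = fromFin-toFin (R A)

  vertexOf-active : ∀ {A} → InXk k A → Active (vertexOf A)
  vertexOf-active A∈Xk = toFin-active (_ , A∈Xk , refl)

  cluster-vertexOf : ∀ {A} → InXk k A → ∀ x →
                     x ∈ R A ⇔ InCluster E leaf x (vertexOf A)
  cluster-vertexOf {A} A∈Xk x =
    subst (λ C → x ∈ C ⇔ InCluster E leaf x (vertexOf A)) (label-vertexOf A)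
          (cluster-active (vertexOf-active A∈Xk) x)

  vertexOf-commonAnc : ∀ {A} → InXk k A → CommonAnc E leaf A (vertexOf A)
  vertexOf-commonAnc {A} A∈Xk x x∈A =
    Equivalence.to (cluster-vertexOf A∈Xk x) (proj₁ transit A A∈Xk x∈A)

  vertexOf-least : ∀ {A w} → InXk k A → CommonAnc E leaf A w → vertexOf A ⪯ w
  vertexOf-least {A} {w} A∈Xk w-anc with active-ancestor w
  ... | w′ , aw′ , w′⪯w , cluster-w⊆w′ =
    ⪯-trans (⊆⇒⪯ aw′ (vertexOf-active A∈Xk) RA⊆w′) w′⪯w
    where
    A⊆w′ : A ⊆ label w′
    A⊆w′ {x} x∈A = leaf⪯⇒∈label aw′ (cluster-w⊆w′ x (w-anc x x∈A))
    RA⊆w′ : label (vertexOf A) ⊆ label w′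
    RA⊆w′ rewrite label-vertexOf A = R-least A∈Xk aw′ A⊆w′

  lca-vertexOf : ∀ {A} → InXk k A → IsLCA E leaf A (vertexOf A)
  lca-vertexOf A∈Xk = vertexOf-commonAnc A∈Xk , λ w w-anc w⪯v →
    acyclic⇒⪯-antisym acyclic w⪯v (vertexOf-least A∈Xk w-anc)

  kLcaProperty : HasKLcaProperty k E leaf
  kLcaProperty A A∈Xk = vertexOf A , lca-vertexOf A∈Xk , λ w (w-anc , w-minimal) →
    sym (w-minimal (vertexOf A) (vertexOf-commonAnc A∈Xk) (vertexOf-least A∈Xk w-anc))

  sameSetSystem : SameSetSystem k E leaf R
  sameSetSystem = cluster⇒transit , λ U U∈Xk → vertexOf U , cluster-vertexOf U∈Xk
    where
    cluster⇒transit : ∀ v →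
                      ∃ λ U → InXk k U × (∀ x → x ∈ R U ⇔ InCluster E leaf x v)
    cluster⇒transit v with active? v
    ... | yes av@(U , U∈Xk , RU≡label-v) = U , U∈Xk , λ x →
      subst (λ C → x ∈ C ⇔ InCluster E leaf x v) (sym RU≡label-v) (cluster-active av x)
    ... | no ¬a = ⁅ fz ⁆ , ⁅⁆∈Xk fz , λ x →
      subst (λ C → x ∈ C ⇔ InCluster E leaf x v) (sym (proj₂ transit fz))
            (cluster-inactive ¬a x)

  canonical : CanonicalIs k E leaf R
  canonical U U∈Xk x = mk⇔
    (λ x∈RU v v-anc →
      ⪯-trans (Equivalence.to (cluster-vertexOf U∈Xk x) x∈RU) (vertexOf-least U∈Xk v-anc))
    (λ x∈clusters →
      Equivalence.from (cluster-vertexOf U∈Xk x) (x∈clusters _ (vertexOf-commonAnc U∈Xk)))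

  representingDAG : RepresentingDAG k R
  representingDAG =
    _ , E , leaf , acyclic , leafSet , kLcaProperty , sameSetSystem , canonical

theorem2 : ∀ (n : ℕ) (k : ℕ) → 1 ≤ k → (R : Subset (suc n) → Subset (suc n)) →
    IsTransit k R → (IsMonotone k R ⇔ RepresentingDAG k R)
theorem2 n k k≥1 R transit =
  mk⇔ (TransitDAG.representingDAG n k k≥1 R transit) representingDAG⇒monotone
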